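{- Let $k\ge2$ and $m_1,\dots,m_k\in\mathbb{Z}$, and put $m=|m_1|+\dots+|m_k|$. For every $n\ge0$, the number $c_n(R,m_1,\dots,m_k)$ of walks of length $n$ in $R$ from $0$ coming successively through $m_1,\ m_1+m_2,\ \dots,\ m_1+\dots+m_{k-1}$ to $m_1+\dots+m_k$ satisfies $$c_n(R,m_1,\dots,m_k)=c_n(R,m)=\begin{cases}\binom{n}{(n-m)/2}&\text{if } n-m\text{ is even},\\0&\text{otherwise.}\end{cases}$$
   Context: $R$ is the graph with vertex set $\mathbb{Z}$ and an undirected edge between $j$ and $j+1$ for every $j\in\mathbb{Z}$. A walk of length $n$ is a sequence $x_0,\dots,x_n$ of integers with $|x_i-x_{i-1}|=1$. A walk from $w_0$ coming successively through $w_1,\dots,w_{k-1}$ to $w_k$ is a walk with $x_0=w_0$, $x_n=w_k$ for which there exist indices $0\le i_1\le i_2\le\dots\le i_{k-1}\le n$ with $x_{i_j}=w_j$ for all $j$. $c_n(R,m)$ denotes the number of walks of length $n$ from $0$ to $m$. Convention: $\binom{n}{r}=0$ for $r<0$ or $r>n$. -}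

module Defs where

open import Data.Nat using (ℕ; zero; suc; _≤_; _∸_; _≤?_; _%_)
open import Data.Nat.Combinatorics using (_C_)
open import Data.Integer using (ℤ; ∣_∣; _-_; _+_; +_)
open import Data.Fin using (Fin; fromℕ) renaming (zero to fz; suc to fs; _≤_ to _≤ᶠ_)
open import Data.Vec using (Vec; []; _∷_; lookup; head; last; foldr)
open import Data.List using (List; length)
open import Data.List.Membership.Propositional using (_∈_)
open import Data.List.Relation.Unary.Unique.Propositional using (Unique)
open import Data.Product using (Σ; _×_; ∃)
open import Function.Bundles using (_⇔_)
open import Relation.Binary.PropositionalEquality using (_≡_)
open import Relation.Nullary.Decidable using (yes; no)
open import Data.Nat using (_≟_)

IsWalk : ∀ {n} → Vec ℤ (suc n) → Set
IsWalk (x ∷ []) = Data.Unit.⊤ where import Data.Unit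
IsWalk (x ∷ y ∷ xs) = (∣ y - x ∣ ≡ 1) × IsWalk (y ∷ xs)

-- The walk w (of length n) goes from ws_0 coming successively through
-- ws_1,…,ws_{k-1} to ws_k: there are indices 0 = i_0 ≤ i_1 ≤ … ≤ i_k = n
-- with x_{i_j} = ws_j for all j (i_0 = 0 and i_k = n encode x_0 = ws_0, x_n = ws_k).
ThroughSuccessively : ∀ {n k} → Vec ℤ (suc n) → Vec ℤ (suc k) → Set
ThroughSuccessively {n} {k} w ws =
  Σ (Fin (suc k) → Fin (suc n)) λ idx →
    (idx fz ≡ fz) × (idx (fromℕ k) ≡ fromℕ n) ×
    (∀ i j → i ≤ᶠ j → idx i ≤ᶠ idx j) ×
    (∀ j → lookup w (idx j) ≡ lookup ws j)

HasCount : {A : Set} → (A → Set) → ℕ → Set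
HasCount {A} P N =
  Σ (List A) λ L → Unique L × (∀ x → (x ∈ L) ⇔ P x) × (length L ≡ N)

partialSums : ∀ {k} → Vec ℤ k → Vec ℤ (suc k)
partialSums [] = + 0 ∷ []
partialSums (a ∷ as) = + 0 ∷ Data.Vec.map (λ s → a + s) (partialSums as)

absSum : ∀ {k} → Vec ℤ k → ℕ
absSum = foldr _ (λ a s → ∣ a ∣ Data.Nat.+ s) 0

-- binom(n, (n-m)/2) if n-m is even, 0 otherwise (binom(n,r) = 0 for r < 0;
-- n - m < 0 exactly when m > n).
walkFormula : ℕ → ℕ → ℕ
walkFormula n m with m ≤? n
... | no _ = 0
... | yes _ with (n ∸ m) % 2 ≟ 0
...   | yes _ = n C ((n ∸ m) Data.Nat./ 2)
...   | no _ = 0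

-- Read step by step, a walk passing its waypoints in order either visits the next waypoint where it
-- stands or takes a step. A waypoint at the current position may as well be visited at once, and
-- otherwise the first step changes the distance to the next waypoint by ∓1. So the number of walks
-- of length n through waypoints ws obeys the recursion of the number of walks from 0 to d, with d
-- the total variation of ws, and that number is binomial by Pascal's rule. The total variation of
-- the partial sums of m₁,…,m_k is |m₁| + … + |m_k|.
module Submission where

open import Defs
open import Data.Nat using (ℕ; zero; suc; _+_; _*_; _≤_; _<_; _∸_; _%_; _/_; z≤n; s≤s; _≤?_; _≟_)
open import Data.Nat.Properties using (+-comm; +-suc; +-identityʳ; m≤m+n; m≤n+m; m≤n⇒m≤1+n; m+n∸m≡n; m+[n∸m]≡n; ≰⇒>; ≤-trans; ≤-reflexive; suc-injective)
open import Data.Nat.Combinatorics using (_C_; nCk≡nC[n∸k]; nCk+nC[k+1]≡[n+1]C[k+1])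
open import Data.Nat.DivMod using (m≡m%n+[m/n]*n; m%n<n)
import Data.Nat.Tactic.RingSolver as ℕ-Solver
open import Data.Integer as ℤ using (ℤ; +_; -[1+_]; ∣_∣; _-_; 0ℤ; 1ℤ; -1ℤ)
open import Data.Integer.Properties as ℤ using (∣i∣≡0⇒i≡0; i-j≡0⇒i≡j; i≡j⇒i-j≡0)
import Data.Integer.Tactic.RingSolver as ℤ-Solver
open import Data.Fin using (Fin; pinch) renaming (zero to fz; suc to fs; _≤_ to _≤ᶠ_)
open import Data.Fin.Properties using (pinch-mono-≤)
open import Data.Vec using (Vec; []; _∷_; lookup)
open import Data.Vec.Properties using (∷-injectiveʳ)
open import Data.List using ([]; _∷_; [_]; map; _++_)
open import Data.List.Properties using (length-map; length-++)
open import Data.List.Relation.Unary.Any using (here)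
open import Data.List.Relation.Unary.All using ([])
open import Data.List.Relation.Unary.AllPairs using ([]; _∷_)
open import Data.List.Membership.Propositional.Properties using (∈-map⁺; ∈-map⁻; ∈-++⁺ˡ; ∈-++⁺ʳ; ∈-++⁻)
open import Data.List.Relation.Unary.Unique.Propositional.Properties using (map⁺; ++⁺)
open import Data.Product using (∃; _×_; _,_; proj₁)
open import Data.Product.Function.NonDependent.Propositional using (_×-⇔_)
open import Data.Sum as Sum using (_⊎_; inj₁; inj₂)
open import Data.Unit using (tt)
open import Data.Empty using (⊥; ⊥-elim)
open import Function using (_∘_; case_of_)
open import Function.Bundles using (_⇔_; mk⇔; Equivalence)
import Function.Properties.Equivalence as ⇔
open import Relation.Binary.PropositionalEquality using (_≡_; _≢_; refl; sym; trans; cong; cong₂; subst; module ≡-Reasoning)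
open import Relation.Nullary using (¬_; yes; no)

module _ {A : Set} where

  Image : {B : Set} → (A → B) → (A → Set) → B → Set
  Image f P y = ∃ λ x → P x × f x ≡ y

  HasCount-⇔ : ∀ {P Q : A → Set} {N} → (∀ x → P x ⇔ Q x) → HasCount P N → HasCount Q N
  HasCount-⇔ P⇔Q (L , unique , mem , len) = L , unique , (λ x → ⇔.trans (mem x) (P⇔Q x)) , len

  HasCount-∅ : ∀ {P : A → Set} → (∀ x → ¬ P x) → HasCount P 0
  HasCount-∅ ¬P = [] , [] , (λ x → mk⇔ (λ ()) (⊥-elim ∘ ¬P x)) , refl

  HasCount-singleton : (a : A) → HasCount (_≡ a) 1
  HasCount-singleton a = [ a ] , [] ∷ [] , (λ x → mk⇔ (λ { (here refl) → refl }) (λ { refl → here refl })) , refl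

  HasCount-⊎ : ∀ {P Q : A → Set} {m n} → (∀ {x} → P x → Q x → ⊥) →
    HasCount P m → HasCount Q n → HasCount (λ x → P x ⊎ Q x) (m + n)
  HasCount-⊎ disjoint (L , uL , memL , lenL) (M , uM , memM , lenM) =
    L ++ M ,
    ++⁺ uL uM (λ (∈L , ∈M) → disjoint (to (memL _) ∈L) (to (memM _) ∈M)) ,
    (λ x → mk⇔ (Sum.map (to (memL x)) (to (memM x)) ∘ ∈-++⁻ L)
               Sum.[ ∈-++⁺ˡ ∘ from (memL x) , ∈-++⁺ʳ L ∘ from (memM x) ]) ,
    trans (length-++ L) (cong₂ _+_ lenL lenM)
    where open Equivalence

  HasCount-map : ∀ {B : Set} {P : A → Set} {n} (f : A → B) → (∀ {x y} → f x ≡ f y → x ≡ y) →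
    HasCount P n → HasCount (Image f P) n
  HasCount-map f injective (L , uL , memL , lenL) =
    map f L ,
    map⁺ injective uL ,
    (λ y → mk⇔ (λ y∈ → let (x , x∈ , y≡fx) = ∈-map⁻ f y∈ in x , to (memL x) x∈ , sym y≡fx)
               (λ { (x , Px , refl) → ∈-map⁺ f (from (memL x) Px) })) ,
    trans (length-map f L) lenL
    where open Equivalence

-- ℤ.suc i unfolds to 1ℤ + i, which is the form the ring solver can read.
j-suc[i]≡pred[j-i] : ∀ i j → j - ℤ.suc i ≡ ℤ.pred (j - i)
j-suc[i]≡pred[j-i] = identity
  where identity : ∀ i j → j - ℤ._+_ 1ℤ i ≡ ℤ._+_ -1ℤ (j - i)
        identity = ℤ-Solver.solve-∀

j-pred[i]≡suc[j-i] : ∀ i j → j - ℤ.pred i ≡ ℤ.suc (j - i)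
j-pred[i]≡suc[j-i] = identity
  where identity : ∀ i j → j - ℤ._+_ -1ℤ i ≡ ℤ._+_ 1ℤ (j - i)
        identity = ℤ-Solver.solve-∀

suc[i]-i≡1 : ∀ i → ℤ.suc i - i ≡ 1ℤ
suc[i]-i≡1 = identity
  where identity : ∀ i → ℤ._+_ 1ℤ i - i ≡ 1ℤ
        identity = ℤ-Solver.solve-∀

pred[i]-i≡-1 : ∀ i → ℤ.pred i - i ≡ -1ℤ
pred[i]-i≡-1 = identity
  where identity : ∀ i → ℤ._+_ -1ℤ i - i ≡ -1ℤ
        identity = ℤ-Solver.solve-∀

suc[i]≢pred[i] : ∀ i → ℤ.suc i ≢ ℤ.pred i
suc[i]≢pred[i] i eq with trans (sym (suc[i]-i≡1 i)) (trans (cong (_- i) eq) (pred[i]-i≡-1 i))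
... | ()

∣i∣≡1⇒i≡±1 : ∀ i → ∣ i ∣ ≡ 1 → i ≡ 1ℤ ⊎ i ≡ -1ℤ
∣i∣≡1⇒i≡±1 (+ 1) _ = inj₁ refl
∣i∣≡1⇒i≡±1 -[1+ 0 ] _ = inj₂ refl

neighbour : ∀ i j → ∣ j - i ∣ ≡ 1 → j ≡ ℤ.suc i ⊎ j ≡ ℤ.pred i
neighbour i j step with ∣i∣≡1⇒i≡±1 (j - i) step
... | inj₁ j-i≡1 = inj₁ (i-j≡0⇒i≡j j (ℤ.suc i) (trans (j-suc[i]≡pred[j-i] i j) (cong ℤ.pred j-i≡1)))
... | inj₂ j-i≡-1 = inj₂ (i-j≡0⇒i≡j j (ℤ.pred i) (trans (j-pred[i]≡suc[j-i] i j) (cong ℤ.suc j-i≡-1)))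

i≢j⇒0<∣j-i∣ : ∀ {i j} → i ≢ j → 0 < ∣ j - i ∣
i≢j⇒0<∣j-i∣ {i} {j} i≢j with ∣ j - i ∣ in eq
... | suc _ = s≤s z≤n
... | zero = ⊥-elim (i≢j (sym (i-j≡0⇒i≡j j i (∣i∣≡0⇒i≡0 eq))))

-- Through w (x ∷ ws): the walk w, currently at x, still has to pass the waypoints ws in order
-- and end at the last of them.
data Through : ∀ {n k} → Vec ℤ (suc n) → Vec ℤ (suc k) → Set where
  arrive : ∀ {x} → Through (x ∷ []) (x ∷ [])
  visit : ∀ {n k x} {xs : Vec ℤ n} {ws : Vec ℤ k} →
    Through (x ∷ xs) (x ∷ ws) → Through (x ∷ xs) (x ∷ x ∷ ws)
  move : ∀ {n k x y b} {xs : Vec ℤ n} {ws : Vec ℤ k} →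
    Through (y ∷ xs) (y ∷ b ∷ ws) → Through (x ∷ y ∷ xs) (x ∷ b ∷ ws)

TS-visit : ∀ {n k x} {xs : Vec ℤ n} {ws : Vec ℤ k} →
  ThroughSuccessively (x ∷ xs) (x ∷ ws) → ThroughSuccessively (x ∷ xs) (x ∷ x ∷ ws)
TS-visit {n} {k} {x} {xs} {ws} (idx , _ , last , mono , hits) = idx′ , refl , last , mono′ , hits′
  where
  idx′ : Fin (suc (suc k)) → Fin (suc n)
  idx′ fz = fz
  idx′ (fs j) = idx j
  mono′ : ∀ i j → i ≤ᶠ j → idx′ i ≤ᶠ idx′ j
  mono′ fz _ _ = z≤n
  mono′ (fs i) (fs j) (s≤s i≤j) = mono i j i≤j
  hits′ : ∀ j → lookup (x ∷ xs) (idx′ j) ≡ lookup (x ∷ x ∷ ws) j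
  hits′ fz = refl
  hits′ (fs j) = hits j

TS-move : ∀ {n k x y b} {xs : Vec ℤ n} {ws : Vec ℤ k} →
  ThroughSuccessively (y ∷ xs) (y ∷ b ∷ ws) → ThroughSuccessively (x ∷ y ∷ xs) (x ∷ b ∷ ws)
TS-move {n} {k} {x} {y} {b} {xs} {ws} (idx , _ , last , mono , hits) = idx′ , refl , cong fs last , mono′ , hits′
  where
  idx′ : Fin (suc (suc k)) → Fin (suc (suc n))
  idx′ fz = fz
  idx′ (fs j) = fs (idx (fs j))
  mono′ : ∀ i j → i ≤ᶠ j → idx′ i ≤ᶠ idx′ j
  mono′ fz _ _ = z≤n
  mono′ (fs i) (fs j) i≤j = s≤s (mono (fs i) (fs j) i≤j)
  hits′ : ∀ j → lookup (x ∷ y ∷ xs) (idx′ j) ≡ lookup (x ∷ b ∷ ws) j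
  hits′ fz = refl
  hits′ (fs j) = hits (fs j)

Through⇒TS : ∀ {n k} {w : Vec ℤ (suc n)} {ws : Vec ℤ (suc k)} → Through w ws → ThroughSuccessively w ws
Through⇒TS arrive = (λ _ → fz) , refl , refl , (λ _ _ _ → z≤n) , λ { fz → refl }
Through⇒TS (visit t) = TS-visit (Through⇒TS t)
Through⇒TS (move t) = TS-move (Through⇒TS t)

TS-head : ∀ {n k x a} {xs : Vec ℤ n} {ws : Vec ℤ k} → ThroughSuccessively (x ∷ xs) (a ∷ ws) → x ≡ a
TS-head {xs = xs} (idx , first , _ , _ , hits) = trans (cong (lookup (_ ∷ xs)) (sym first)) (hits fz)

TS-unvisit : ∀ {n k a b} {w : Vec ℤ (suc n)} {ws : Vec ℤ k} →
  (ts : ThroughSuccessively w (a ∷ b ∷ ws)) → proj₁ ts (fs fz) ≡ fz → ThroughSuccessively w (b ∷ ws)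
TS-unvisit (idx , _ , last , mono , hits) second =
  idx ∘ fs , second , last , (λ i j i≤j → mono (fs i) (fs j) (s≤s i≤j)) , hits ∘ fs

TS-unmove : ∀ {n k x y a b} {xs : Vec ℤ n} {ws : Vec ℤ k} {i : Fin (suc n)} →
  (ts : ThroughSuccessively (x ∷ y ∷ xs) (a ∷ b ∷ ws)) → proj₁ ts (fs fz) ≡ fs i →
  ThroughSuccessively (y ∷ xs) (y ∷ b ∷ ws)
TS-unmove {n} {k} {x} {y} {a} {b} {xs} {ws} {i} (idx , _ , last , mono , hits) second =
  idx′ , refl , cong (pinch fz) last , mono′ , hits′
  where
  idx′ : Fin (suc (suc k)) → Fin (suc n)
  idx′ fz = fz
  idx′ (fs j) = pinch fz (idx (fs j))  -- idx (fs j) ≥ fs i > fz, so this lowers it by one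
  mono′ : ∀ i j → i ≤ᶠ j → idx′ i ≤ᶠ idx′ j
  mono′ fz _ _ = z≤n
  mono′ (fs i) (fs j) i≤j = pinch-mono-≤ fz (mono (fs i) (fs j) i≤j)
  lookup-pinch : ∀ f → fs i ≤ᶠ f → lookup (y ∷ xs) (pinch fz f) ≡ lookup (x ∷ y ∷ xs) f
  lookup-pinch (fs _) _ = refl
  hits′ : ∀ j → lookup (y ∷ xs) (idx′ j) ≡ lookup (y ∷ b ∷ ws) j
  hits′ fz = refl
  hits′ (fs j) = trans (lookup-pinch (idx (fs j)) (subst (_≤ᶠ idx (fs j)) second (mono (fs fz) (fs j) (s≤s z≤n)))) (hits (fs j))

TS-last : ∀ {n x a} {xs : Vec ℤ n} → ThroughSuccessively (x ∷ xs) (a ∷ []) → Through (x ∷ xs) (a ∷ [])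
TS-last {zero} {xs = []} ts with TS-head ts
... | refl = arrive
TS-last {suc n} (_ , first , last , _) with trans (sym first) last
... | ()

TS⇒Through : ∀ {n k} {w : Vec ℤ (suc n)} {ws : Vec ℤ (suc k)} → ThroughSuccessively w ws → Through w ws
TS⇒Through {w = _ ∷ _} {ws = _ ∷ []} ts = TS-last ts
TS⇒Through {w = x ∷ xs} {ws = _ ∷ b ∷ _} ts with TS-head ts | proj₁ ts (fs fz) in second
... | refl | fz with TS-head {x = x} {b} {xs} (TS-unvisit {w = x ∷ xs} ts second)
...   | refl = visit (TS⇒Through (TS-unvisit {w = x ∷ xs} ts second))
TS⇒Through {w = _ ∷ _ ∷ _} {ws = _ ∷ _ ∷ _} ts | refl | fs i = move (TS⇒Through (TS-unmove ts second))

Through-head : ∀ {n k x a} {xs : Vec ℤ n} {ws : Vec ℤ k} → Through (x ∷ xs) (a ∷ ws) → x ≡ a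
Through-head arrive = refl
Through-head (visit _) = refl
Through-head (move _) = refl

Through-drop : ∀ {n k a b c} {w : Vec ℤ (suc n)} {ws : Vec ℤ k} → Through w (a ∷ b ∷ c ∷ ws) → Through w (a ∷ c ∷ ws)
Through-drop (visit t) = t
Through-drop (move t) = move (Through-drop t)

Through-stationary : ∀ {k x a b} {ws : Vec ℤ k} → Through (x ∷ []) (a ∷ b ∷ ws) → a ≡ b
Through-stationary (visit _) = refl

-- Visiting a waypoint as soon as the walk stands on it loses no walks.
visit⇔ : ∀ {n k x a b} {xs : Vec ℤ n} {ws : Vec ℤ k} →
  Through (x ∷ xs) (a ∷ a ∷ b ∷ ws) ⇔ Through (x ∷ xs) (a ∷ b ∷ ws)
visit⇔ = mk⇔ Through-drop λ t → case Through-head t of λ { refl → visit t }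

visit-stationary⇔ : ∀ {k x a} {ws : Vec ℤ k} → Through (x ∷ []) (a ∷ a ∷ ws) ⇔ Through (x ∷ []) (a ∷ ws)
visit-stationary⇔ = mk⇔ (λ { (visit t) → t }) λ t → case Through-head t of λ { refl → visit t }

move⇔ : ∀ {n k x y a b} {xs : Vec ℤ n} {ws : Vec ℤ k} → a ≢ b →
  Through (x ∷ y ∷ xs) (a ∷ b ∷ ws) ⇔ (x ≡ a × Through (y ∷ xs) (y ∷ b ∷ ws))
move⇔ a≢b = mk⇔ (λ { (visit _) → ⊥-elim (a≢b refl) ; (move t) → refl , t }) (λ { (refl , t) → move t })

move-last⇔ : ∀ {n x y a b} {xs : Vec ℤ n} →
  Through (x ∷ y ∷ xs) (a ∷ b ∷ []) ⇔ (x ≡ a × Through (y ∷ xs) (y ∷ b ∷ []))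
move-last⇔ = mk⇔ (λ { (visit ()) ; (move t) → refl , t }) (λ { (refl , t) → move t })

WalkThrough : ∀ {n k} → Vec ℤ (suc k) → Vec ℤ (suc n) → Set
WalkThrough ws w = IsWalk w × Through w ws

walks-first-step : ∀ {n k p q} a (ws : Vec ℤ (suc k)) →
  (∀ {x y} {xs : Vec ℤ n} → Through (x ∷ y ∷ xs) (a ∷ ws) ⇔ (x ≡ a × Through (y ∷ xs) (y ∷ ws))) →
  HasCount (WalkThrough (ℤ.suc a ∷ ws)) p → HasCount (WalkThrough (ℤ.pred a ∷ ws)) q →
  HasCount (WalkThrough (a ∷ ws)) (p + q)
walks-first-step a ws first up down =
  HasCount-⇔ split (HasCount-⊎ disjoint (HasCount-map (a ∷_) ∷-injectiveʳ up) (HasCount-map (a ∷_) ∷-injectiveʳ down))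
  where
  open Equivalence
  disjoint : ∀ {w} → Image (a ∷_) (WalkThrough (ℤ.suc a ∷ ws)) w → Image (a ∷_) (WalkThrough (ℤ.pred a ∷ ws)) w → ⊥
  disjoint ((_ ∷ _) , (_ , t) , refl) (_ , (_ , t′) , refl) = suc[i]≢pred[i] a (trans (sym (Through-head t)) (Through-head t′))
  extend : ∀ {b} → ∣ b - a ∣ ≡ 1 → ∀ v → WalkThrough (b ∷ ws) v → WalkThrough (a ∷ ws) (a ∷ v)
  extend b-a (_ ∷ _) (walk , t) with Through-head t
  ... | refl = (b-a , walk) , from first (refl , t)
  restrict : ∀ w → WalkThrough (a ∷ ws) w →
    Image (a ∷_) (WalkThrough (ℤ.suc a ∷ ws)) w ⊎ Image (a ∷_) (WalkThrough (ℤ.pred a ∷ ws)) w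
  restrict (_ ∷ y ∷ xs) ((step , walk) , t) with to first t
  ... | refl , t′ with neighbour a y step
  ...   | inj₁ refl = inj₁ ((y ∷ xs) , (walk , t′) , refl)
  ...   | inj₂ refl = inj₂ ((y ∷ xs) , (walk , t′) , refl)
  split : ∀ w →
    (Image (a ∷_) (WalkThrough (ℤ.suc a ∷ ws)) w ⊎ Image (a ∷_) (WalkThrough (ℤ.pred a ∷ ws)) w) ⇔ WalkThrough (a ∷ ws) w
  split w = mk⇔
    (λ { (inj₁ (v , wt , refl)) → extend (cong ∣_∣ (suc[i]-i≡1 a)) v wt
       ; (inj₂ (v , wt , refl)) → extend (cong ∣_∣ (pred[i]-i≡-1 a)) v wt })
    (restrict w)

-- The number of walks of length n from 0 to d: the first step leaves a distance d ∓ 1 to cover.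
walkCount : ℕ → ℕ → ℕ
walkCount zero zero = 1
walkCount zero (suc _) = 0
walkCount (suc n) zero = walkCount n 1 + walkCount n 1
walkCount (suc n) (suc d) = walkCount n d + walkCount n (suc (suc d))

walkCount-suc : ∀ n t e → (t ≡ 0ℤ → e ≡ 0) →
  walkCount n (∣ ℤ.pred t ∣ + e) + walkCount n (∣ ℤ.suc t ∣ + e) ≡ walkCount (suc n) (∣ t ∣ + e)
walkCount-suc n (+ zero) e t≡0⇒e≡0 rewrite t≡0⇒e≡0 refl = refl
walkCount-suc n (+ suc d) e _ = refl
walkCount-suc n -[1+ zero ] e _ = +-comm (walkCount n (suc (suc e))) (walkCount n e)
walkCount-suc n -[1+ suc d ] e _ = +-comm (walkCount n (suc (suc (suc d)) + e)) (walkCount n (suc d + e))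

walkCount-first-step : ∀ n a b e → (a ≡ b → e ≡ 0) →
  walkCount n (∣ b - ℤ.suc a ∣ + e) + walkCount n (∣ b - ℤ.pred a ∣ + e) ≡ walkCount (suc n) (∣ b - a ∣ + e)
walkCount-first-step n a b e a≡b⇒e≡0
  rewrite j-suc[i]≡pred[j-i] a b | j-pred[i]≡suc[j-i] a b =
  walkCount-suc n (b - a) e (a≡b⇒e≡0 ∘ sym ∘ i-j≡0⇒i≡j b a)

walkCount-beyond : ∀ {n d} → n < d → walkCount n d ≡ 0
walkCount-beyond {zero} {suc _} _ = refl
walkCount-beyond {suc n} {suc d} (s≤s n<d)
  rewrite walkCount-beyond n<d | walkCount-beyond {n} {suc (suc d)} (m≤n⇒m≤1+n (m≤n⇒m≤1+n n<d)) = refl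

totalVariation : ∀ {k} → Vec ℤ (suc k) → ℕ
totalVariation (_ ∷ []) = 0
totalVariation (a ∷ b ∷ ws) = ∣ b - a ∣ + totalVariation (b ∷ ws)

totalVariation-repeat : ∀ {k} a (ws : Vec ℤ k) → totalVariation (a ∷ a ∷ ws) ≡ totalVariation (a ∷ ws)
totalVariation-repeat a ws = cong (λ d → ∣ d ∣ + totalVariation (a ∷ ws)) (i≡j⇒i-j≡0 {a} refl)

walks₀-count : ∀ {k} (ws : Vec ℤ (suc k)) → HasCount (WalkThrough {0} ws) (walkCount 0 (totalVariation ws))
walks₀-count (a ∷ []) =
  HasCount-⇔ (λ { (x ∷ []) → mk⇔ (λ { refl → tt , arrive }) (λ { (_ , arrive) → refl }) }) (HasCount-singleton (a ∷ []))
walks₀-count (a ∷ b ∷ ws) with a ℤ.≟ b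
... | yes refl =
  subst (HasCount _) (cong (walkCount 0) (sym (totalVariation-repeat a ws)))
        (HasCount-⇔ (λ { (_ ∷ []) → ⇔.refl ×-⇔ ⇔.sym visit-stationary⇔ }) (walks₀-count (a ∷ ws)))
... | no a≢b =
  subst (HasCount _) (sym (walkCount-beyond (≤-trans (i≢j⇒0<∣j-i∣ a≢b) (m≤m+n _ _))))
        (HasCount-∅ λ { (_ ∷ []) (_ , t) → a≢b (Through-stationary t) })

walks-count : ∀ n {k} (ws : Vec ℤ (suc (suc k))) → HasCount (WalkThrough {n} ws) (walkCount n (totalVariation ws))
walks-count zero ws = walks₀-count ws
walks-count (suc n) (a ∷ b ∷ []) =
  subst (HasCount _) (walkCount-first-step n a b 0 (λ _ → refl))
        (walks-first-step a (b ∷ []) move-last⇔ (walks-count n _) (walks-count n _))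
walks-count (suc n) (a ∷ b ∷ c ∷ ws) with a ℤ.≟ b
... | yes refl =
  subst (HasCount _) (cong (walkCount (suc n)) (sym (totalVariation-repeat a (c ∷ ws))))
        (HasCount-⇔ (λ { (_ ∷ _) → ⇔.refl ×-⇔ ⇔.sym visit⇔ }) (walks-count (suc n) (a ∷ c ∷ ws)))
... | no a≢b =
  subst (HasCount _) (walkCount-first-step n a b _ (⊥-elim ∘ a≢b))
        (walks-first-step a (b ∷ c ∷ ws) (move⇔ a≢b) (walks-count n _) (walks-count n _))

C-middle : ∀ r → suc (r + r) C suc r ≡ suc (r + r) C r
C-middle r = trans (nCk≡nC[n∸k] (s≤s (m≤n+m r r))) (cong (suc (r + r) C_) (m+n∸m≡n r r))

walkCount-even : ∀ n d r → n ≡ d + (r + r) → walkCount n d ≡ n C r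
walkCount-even zero zero zero _ = refl
walkCount-even (suc n) zero (suc r) eq = begin
    walkCount n 1 + walkCount n 1  ≡⟨ cong₂ _+_ ih ih ⟩
    n C r + n C r                  ≡⟨ cong₂ _+_ refl (sym middle) ⟩
    n C r + n C suc r              ≡⟨ nCk+nC[k+1]≡[n+1]C[k+1] n r ⟩
    suc n C suc r                  ∎
  where open ≡-Reasoning
        n≡1+2r : n ≡ suc (r + r)
        n≡1+2r = trans (suc-injective eq) (+-suc r r)
        ih : walkCount n 1 ≡ n C r
        ih = walkCount-even n 1 r n≡1+2r
        middle : n C suc r ≡ n C r
        middle = subst (λ m → m C suc r ≡ m C r) (sym n≡1+2r) (C-middle r)
walkCount-even (suc n) (suc d) zero eq =
  cong₂ _+_ (walkCount-even n d 0 (suc-injective eq))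
            (walkCount-beyond (subst (_< suc (suc d)) (sym (suc-injective eq)) (s≤s (m≤n⇒m≤1+n (≤-reflexive (+-identityʳ d))))))
walkCount-even (suc n) (suc d) (suc r) eq = begin
    walkCount n d + walkCount n (suc (suc d))  ≡⟨ cong₂ _+_ (walkCount-even n d (suc r) n≡)
                                                            (walkCount-even n (suc (suc d)) r (trans n≡ (shift d r))) ⟩
    n C suc r + n C r                          ≡⟨ +-comm (n C suc r) (n C r) ⟩
    n C r + n C suc r                          ≡⟨ nCk+nC[k+1]≡[n+1]C[k+1] n r ⟩
    suc n C suc r                              ∎
  where open ≡-Reasoning
        n≡ : n ≡ d + (suc r + suc r)
        n≡ = suc-injective eq
        shift : ∀ d r → d + (suc r + suc r) ≡ suc (suc d) + (r + r)
        shift = ℕ-Solver.solve-∀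

walkCount-odd : ∀ n d r → n ≡ d + suc (r + r) → walkCount n d ≡ 0
walkCount-odd zero d r eq with trans eq (+-suc d (r + r))
... | ()
walkCount-odd (suc n) zero zero eq with suc-injective eq
... | refl = refl
walkCount-odd (suc n) zero (suc r) eq = cong₂ _+_ ih ih
  where ih : walkCount n 1 ≡ 0
        ih = walkCount-odd n 1 r (trans (suc-injective eq) (cong suc (+-suc r r)))
walkCount-odd (suc n) (suc d) zero eq =
  cong₂ _+_ (walkCount-odd n d 0 (suc-injective eq))
            (walkCount-beyond (subst (_< suc (suc d)) (sym (suc-injective eq)) (s≤s (≤-reflexive (+-comm d 1)))))
walkCount-odd (suc n) (suc d) (suc r) eq =
  cong₂ _+_ (walkCount-odd n d (suc r) (suc-injective eq))
            (walkCount-odd n (suc (suc d)) r (trans (suc-injective eq) (shift d r)))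
  where shift : ∀ d r → d + suc (suc r + suc r) ≡ suc (suc d) + suc (r + r)
        shift = ℕ-Solver.solve-∀

m≡m%2+[m/2+m/2] : ∀ m → m ≡ m % 2 + (m / 2 + m / 2)
m≡m%2+[m/2+m/2] m = trans (m≡m%n+[m/n]*n m 2) (cong₂ _+_ refl (double (m / 2)))
  where double : ∀ q → q * 2 ≡ q + q
        double = ℕ-Solver.solve-∀

m%2≢0⇒m%2≡1 : ∀ m → m % 2 ≢ 0 → m % 2 ≡ 1
m%2≢0⇒m%2≡1 m m%2≢0 with m % 2 | m%n<n m 2
... | zero | _ = ⊥-elim (m%2≢0 refl)
... | suc zero | _ = refl
... | suc (suc _) | s≤s (s≤s ())

n≡d+[parity+2half] : ∀ {n d b} → d ≤ n → (n ∸ d) % 2 ≡ b → n ≡ d + (b + ((n ∸ d) / 2 + (n ∸ d) / 2))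
n≡d+[parity+2half] {n} {d} d≤n parity =
  trans (sym (m+[n∸m]≡n d≤n)) (cong₂ _+_ refl (trans (m≡m%2+[m/2+m/2] (n ∸ d)) (cong₂ _+_ parity refl)))

walkCount≡walkFormula : ∀ n d → walkCount n d ≡ walkFormula n d
walkCount≡walkFormula n d with d ≤? n
... | no d≰n = walkCount-beyond (≰⇒> d≰n)
... | yes d≤n with (n ∸ d) % 2 ≟ 0
...   | yes even = walkCount-even n d ((n ∸ d) / 2) (n≡d+[parity+2half] d≤n even)
...   | no odd = walkCount-odd n d ((n ∸ d) / 2) (n≡d+[parity+2half] d≤n (m%2≢0⇒m%2≡1 (n ∸ d) odd))

∣a+0-0∣≡∣a∣ : ∀ a → ∣ ℤ._+_ a 0ℤ - 0ℤ ∣ ≡ ∣ a ∣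
∣a+0-0∣≡∣a∣ a = cong ∣_∣ (trans (ℤ.+-identityʳ _) (ℤ.+-identityʳ a))

totalVariation-translate : ∀ {k} c (ws : Vec ℤ (suc k)) → totalVariation (Data.Vec.map (ℤ._+_ c) ws) ≡ totalVariation ws
totalVariation-translate c (_ ∷ []) = refl
totalVariation-translate c (a ∷ b ∷ ws) = cong₂ _+_ (cong ∣_∣ (translate c a b)) (totalVariation-translate c (b ∷ ws))
  where translate : ∀ c a b → ℤ._+_ c b - ℤ._+_ c a ≡ b - a
        translate = ℤ-Solver.solve-∀

totalVariation-partialSums : ∀ {k} (ms : Vec ℤ k) → totalVariation (partialSums ms) ≡ absSum ms
totalVariation-partialSums [] = refl
totalVariation-partialSums (a ∷ []) = cong₂ _+_ (∣a+0-0∣≡∣a∣ a) refl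
totalVariation-partialSums (a ∷ b ∷ ms) =
  cong₂ _+_ (∣a+0-0∣≡∣a∣ a) (trans (totalVariation-translate a (partialSums (b ∷ ms))) (totalVariation-partialSums (b ∷ ms)))

totalVariation-segment : ∀ m → totalVariation (+ 0 ∷ + m ∷ []) ≡ m
totalVariation-segment m = trans (+-identityʳ _) (+-identityʳ m)

walksThrough-count : ∀ n {k} (ws : Vec ℤ (suc (suc k))) →
  HasCount (λ (w : Vec ℤ (suc n)) → IsWalk w × ThroughSuccessively w ws) (walkFormula n (totalVariation ws))
walksThrough-count n ws =
  subst (HasCount _) (walkCount≡walkFormula n (totalVariation ws))
        (HasCount-⇔ (λ _ → ⇔.refl ×-⇔ mk⇔ Through⇒TS TS⇒Through) (walks-count n ws))

theorem25 : (k : ℕ) → 2 ≤ k → (ms : Vec ℤ k) → (n : ℕ) →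
    HasCount (λ (w : Vec ℤ (suc n)) → IsWalk w × ThroughSuccessively w (partialSums ms)) (walkFormula n (absSum ms))
    × HasCount (λ (w : Vec ℤ (suc n)) → IsWalk w × ThroughSuccessively w (+ 0 ∷ + absSum ms ∷ [])) (walkFormula n (absSum ms))
theorem25 (suc k) _ ms n =
  subst (HasCount _) (cong (walkFormula n) (totalVariation-partialSums ms)) (walksThrough-count n (partialSums ms)) ,
  subst (HasCount _) (cong (walkFormula n) (totalVariation-segment (absSum ms))) (walksThrough-count n (+ 0 ∷ + absSum ms ∷ []))
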